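{- Let $\mathcal{F}$ be the M-NAE version of a set $\mathcal{C}$ of 3-literal clauses, and let $N=|U_3|$. Then $$\frac{2(N-1)}{5}\le mfvs(G^\triangleleft(\mathcal{F}))=t_s(\mathcal{F})\le\frac{2(N-1)}{5}+1.$$
   Context: The clauses. Let $X=\{x_1,\dots,x_n\}$ and let $\mathcal{C}=\{C_1,\dots,C_m\}$. Each clause involves three distinct variables and is written $C_r=(l_i\vee l_j\vee l_k)$ with $i<j<k$ and $l_u\in\{x_u,\overline{x_u}\}$. The variables. Let $U_2=\{y_1,\dots,y_n,w_1,\dots,w_m,z\}$ and $U_3=\{z\}\cup\bigcup_{g\in U_2\setminus\{z\}}\{\alpha_g,\beta_g,a_g,b_g,c_g\}$. The M-NAE version $\mathcal{F}$ is the following set of monotone clauses over $U_3$, with literal order as written: - for each $C_r$, the clauses $(\gamma_i\vee\gamma_j\vee\alpha_{w_r})$ and $(\beta_{w_r}\vee\gamma_k\vee z)$, where $\gamma_u=\alpha_{y_u}$ if $l_u=x_u$ and $\gamma_u=\beta_{y_u}$ if $l_u=\overline{x_u}$; - for each $g\in U_2\setminus\{z\}$, the clauses $(\alpha_g\vee\beta_g\vee a_g)$, $(\alpha_g\vee\beta_g\vee b_g)$, $(\alpha_g\vee\beta_g\vee c_g)$ and $(a_g\vee b_g\vee c_g)$. The representative graph $G^\triangleleft(\mathcal{F})$ has vertex set $U_3$ and an arc $uv$ iff some clause $(p\vee q\vee r)$ of $\mathcal{F}$, in the written order, has $(u,v)\in\{(p,q),(q,r),(r,p)\}$. A feedback vertex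 set of a digraph $G=(V,E)$ is a set $S\subsetneq V$ meeting every directed cycle, and $mfvs(G)$ is its minimum size. $t_s(\mathcal{F})$ is the minimum number of true variables in a truth assignment making every clause of $\mathcal{F}$ contain a true literal. -}

module Defs where

open import Data.Nat using (ℕ; _+_; _*_; _∸_; _≤_)
open import Data.Fin using (Fin) renaming (_<_ to _<ᶠ_)
open import Data.Bool using (Bool; true; false)
open import Data.Product using (Σ; ∃; _×_; _,_)
open import Data.Sum using (_⊎_)
open import Data.List using (List; []; _∷_; _∷ʳ_; length)
open import Data.List.Membership.Propositional using (_∈_; _∉_)
open import Data.List.Relation.Unary.Any using (Any)
open import Data.List.Relation.Unary.Linked using (Linked)
open import Data.List.Relation.Unary.Unique.Propositional using (Unique)
open import Relation.Binary.PropositionalEquality using (_≡_)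

-- A 3-literal clause (l_i ∨ l_j ∨ l_k) over x_1..x_n with i < j < k.
-- The sign bit is true for the positive literal x_u, false for ¬x_u.
record Clause3 (n : ℕ) : Set where
  field
    i j k    : Fin n
    i<j      : i <ᶠ j
    j<k      : j <ᶠ k
    si sj sk : Bool

-- U_2 \ {z} : the elements y_1..y_n and w_1..w_m
data G (n m : ℕ) : Set where
  y : Fin n → G n m
  w : Fin m → G n m

-- U_3 = {z} ∪ ⋃_g {α_g, β_g, a_g, b_g, c_g}
data V (n m : ℕ) : Set where
  z : V n m
  α β a b c : G n m → V n m

γ : ∀ {n m} → Fin n → Bool → V n m
γ u true  = α (y u)
γ u false = β (y u)

-- index set of the clauses of the M-NAE version F
data FClause (n m : ℕ) : Set where
  first second : Fin m → FClause n m      -- the two clauses built from C_r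
  gad1 gad2 gad3 gad4 : G n m → FClause n m  -- the four gadget clauses of g

-- the literals (p, q, r) of each clause of F, in written order
lits : ∀ {n m} → (Fin m → Clause3 n) → FClause n m → V n m × V n m × V n m
lits C (first r)  = let open Clause3 (C r) in γ i si , γ j sj , α (w r)
lits C (second r) = let open Clause3 (C r) in β (w r) , γ k sk , z
lits C (gad1 g) = α g , β g , a g
lits C (gad2 g) = α g , β g , b g
lits C (gad3 g) = α g , β g , c g
lits C (gad4 g) = a g , b g , c g

Arc : ∀ {n m} → (Fin m → Clause3 n) → V n m → V n m → Set
Arc C u v = Σ (FClause _ _) λ cl → let (p , q , r) = lits C cl in
  ((u ≡ p) × (v ≡ q)) ⊎ ((u ≡ q) × (v ≡ r)) ⊎ ((u ≡ r) × (v ≡ p))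

IsCycle : ∀ {n m} → (Fin m → Clause3 n) → V n m → List (V n m) → Set
IsCycle C v vs = Unique (v ∷ vs) × Linked (Arc C) ((v ∷ vs) ∷ʳ v)

-- feedback vertex set: a proper subset S ⊊ V (as a duplicate-free list) meeting every directed cycle
IsFVS : ∀ {n m} → (Fin m → Clause3 n) → List (V n m) → Set
IsFVS C S = Unique S × (∃ λ v → v ∉ S)
  × (∀ v vs → IsCycle C v vs → Any (_∈ S) (v ∷ vs))

IsMFVS : ∀ {n m} → (Fin m → Clause3 n) → ℕ → Set
IsMFVS C k = (Σ (List _) λ S → IsFVS C S × length S ≡ k)
  × (∀ S → IsFVS C S → k ≤ length S)

-- a truth assignment is given by its set T of true variables;
-- it satisfies F iff every (monotone) clause has a literal in T
Satisfies : ∀ {n m} → (Fin m → Clause3 n) → List (V n m) → Set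
Satisfies C T = ∀ cl → let (p , q , r) = lits C cl in (p ∈ T) ⊎ (q ∈ T) ⊎ (r ∈ T)

IsTs : ∀ {n m} → (Fin m → Clause3 n) → ℕ → Set
IsTs C k = (Σ (List _) λ T → Unique T × Satisfies C T × length T ≡ k)
  × (∀ T → Unique T → Satisfies C T → k ≤ length T)

module Submission where

-- The M-NAE version F of a 3-CNF C over x_1..x_n with clauses C_1..C_m has
-- N = 1 + 5(n+m) vertices: z and, for each of the n+m elements g of U_2∖{z},
-- a gadget {α_g, β_g, a_g, b_g, c_g}.  We show that mfvs(G◁(F)) = t_s(F) = k
-- with k = 2(n+m) when C is satisfiable and k = 2(n+m)+1 otherwise; the
-- bounds 2(N-1)/5 ≤ k ≤ 2(N-1)/5 + 1 are then arithmetic.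
--
-- Each clause (p ∨ q ∨ r) of F gives the triangle p→q→r→p,
--   so every feedback vertex set satisfies F.  A satisfying set contains two
--   vertices of every gadget; if it contains z or a third vertex of some
--   gadget it has one more, and otherwise α_{y_u} ∈ T decodes to a
--   satisfying assignment of C.
-- * Upper bound.  For a choice tβ of one of α_g, β_g per gadget, the set
--   {chosen_g, a_g : g} (plus z if C is unsatisfiable) satisfies F, and it
--   meets every cycle because a potential strictly increases along the arcs
--   between the remaining vertices.  Since every feedback vertex set
--   satisfies F, this set is optimal for both problems at once.

open import Defs
open import Data.Nat using (ℕ; zero; suc; _+_; _*_; _∸_; _≤_; _<_; z≤n; s≤s)
open import Data.Nat.Properties
  using (≤-antisym; ≤-reflexive; ≤-trans; <-trans; <-irrefl; n<1+n; m≤m+n; m≤n+m; +-monoʳ-<; +-comm; *-suc; *-assoc; *-zeroʳ)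
open import Data.Fin using (Fin; toℕ)
open import Data.Fin.Properties using (toℕ<n; <⇒≢; inj⇒≟; all?)
open import Data.Bool using (Bool; true; false; if_then_else_) renaming (_≟_ to _≟ᵇ_)
open import Data.Maybe using (Maybe; just; nothing)
open import Data.Maybe.Properties using (just-injective)
open import Data.Product using (Σ; ∃; _×_; _,_; proj₁; proj₂)
open import Data.Sum using (_⊎_; inj₁; inj₂)
open import Data.Empty using (⊥; ⊥-elim)
open import Data.Vec using (Vec; []; _∷_; lookup; tabulate; replicate)
open import Data.Vec.Properties using (lookup∘tabulate)
open import Data.List using (List; []; _∷_; _++_; _∷ʳ_; length; map; concatMap; allFin)
open import Data.List.Properties using (length-++; length-map; length-tabulate)
open import Data.List.Membership.Propositional using (_∈_; _∉_; find; lose)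
open import Data.List.Membership.Propositional.Properties
  using (∈-∃++; ∈-map⁺; ∈-map⁻; ∈-allFin; ∈-++⁺ˡ; ∈-++⁺ʳ; ∈-concatMap⁺; ∈-concatMap⁻)
open import Data.List.Relation.Unary.Any using (Any; here; there; any?)
open import Data.List.Relation.Unary.All using (All; []; _∷_)
open import Data.List.Relation.Unary.All.Properties using (¬Any⇒All¬; All¬⇒¬Any)
open import Data.List.Relation.Unary.Linked using (Linked; [-]) renaming (_∷_ to _∷ₗ_)
open import Data.List.Relation.Unary.Unique.Propositional using (Unique; []; _∷_)
open import Data.List.Relation.Unary.Unique.Propositional.Properties
  using (map⁺; ++⁺; allFin⁺)
open import Function using (_∘_; _↔_; Inverse)
open import Function.Bundles using (Injection)
open import Function.Properties.Inverse using (↔⇒↣; ↔-sym)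
open import Relation.Binary using (DecidableEquality)
open import Relation.Binary.PropositionalEquality
open import Relation.Nullary using (¬_; Dec; yes; no; does)
open import Relation.Nullary.Decidable using (map′; _⊎-dec_)

-- Counting with duplicate-free lists

∈-delete : ∀ {A : Set} {e x : A} (p q : List A) → e ∈ p ++ x ∷ q → e ≢ x → e ∈ p ++ q
∈-delete []      q (here refl) e≢x = ⊥-elim (e≢x refl)
∈-delete []      q (there e∈q) e≢x = e∈q
∈-delete (_ ∷ p) q (here refl) e≢x = here refl
∈-delete (_ ∷ p) q (there e∈)  e≢x = there (∈-delete p q e∈ e≢x)

length-delete : ∀ {A : Set} {x : A} (p q : List A) → length (p ++ x ∷ q) ≡ suc (length (p ++ q))
length-delete []      q = refl
length-delete (_ ∷ p) q = cong suc (length-delete p q)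

unique⊆⇒length≤ : ∀ {A : Set} {xs ys : List A} → Unique xs → (∀ {e} → e ∈ xs → e ∈ ys) → length xs ≤ length ys
unique⊆⇒length≤ {xs = []} _ _ = z≤n
unique⊆⇒length≤ {xs = x ∷ xs} (x∉xs ∷ xs!) xs⊆ys with ∈-∃++ (xs⊆ys (here refl))
... | p , q , refl = subst (suc (length xs) ≤_) (sym (length-delete p q))
  (s≤s (unique⊆⇒length≤ xs! (λ e∈xs → ∈-delete p q (xs⊆ys (there e∈xs)) (λ { refl → All¬⇒¬Any x∉xs e∈xs }))))

enumeration-length : ∀ {A : Set} {xs : List A} {N : ℕ} →
  Unique xs → (∀ x → x ∈ xs) → A ↔ Fin N → length xs ≡ N
enumeration-length {xs = xs} {N} xs! complete A↔Fin = ≤-antisym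
  (subst₂ _≤_ (length-map to xs) (length-tabulate {n = N} (λ i → i))
    (unique⊆⇒length≤ (map⁺ (Injection.injective (↔⇒↣ A↔Fin)) xs!) (λ {e} _ → ∈-allFin e)))
  (subst (_≤ length xs) (trans (length-map from (allFin N)) (length-tabulate {n = N} (λ i → i)))
    (unique⊆⇒length≤ (map⁺ (Injection.injective (↔⇒↣ (↔-sym A↔Fin))) (allFin⁺ N)) (λ {e} _ → complete e)))
  where open Inverse A↔Fin

-- Concatenations of labelled blocks: every element of block g carries the
-- label g, so an element can only occur in the block of its label.
module Blocks {A B : Set} (label : A → Maybe B) (block : B → List A)
              (block-labelled : ∀ {g x} → x ∈ block g → label x ≡ just g) where

  blocks-member : ∀ {gs x} → x ∈ concatMap block gs → ∃ λ g → g ∈ gs × label x ≡ just g × x ∈ block g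
  blocks-member x∈ with find (∈-concatMap⁻ block x∈)
  ... | g , g∈gs , x∈block = g , g∈gs , block-labelled x∈block , x∈block

  block⊆blocks : ∀ {gs g x} → g ∈ gs → x ∈ block g → x ∈ concatMap block gs
  block⊆blocks g∈gs x∈block = ∈-concatMap⁺ block (lose g∈gs x∈block)

  unlabelled∉blocks : ∀ {gs x} → label x ≡ nothing → x ∉ concatMap block gs
  unlabelled∉blocks {gs} unlabelled x∈ with blocks-member {gs} x∈
  ... | _ , _ , labelled , _ with trans (sym unlabelled) labelled
  ... | ()

  labelled∉blocks : ∀ {gs g x} → label x ≡ just g → x ∉ block g → x ∉ concatMap block gs
  labelled∉blocks {gs} labelled x∉block x∈ with blocks-member {gs} x∈
  ... | _ , _ , labelled′ , x∈block with just-injective (trans (sym labelled) labelled′)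
  ... | refl = x∉block x∈block

  -- blocks of distinct labels are disjoint, so duplicate-freeness is inherited
  blocks-unique : ∀ {gs} → Unique gs → (∀ g → Unique (block g)) → Unique (concatMap block gs)
  blocks-unique []            _       = []
  blocks-unique {g ∷ gs} (g∉gs ∷ gs!) block! = ++⁺ (block! g) (blocks-unique gs! block!) disjoint
    where
    disjoint : ∀ {x} → ¬ (x ∈ block g × x ∈ concatMap block gs)
    disjoint (x∈block , x∈rest) with blocks-member x∈rest
    ... | g′ , g′∈gs , labelled′ , _ with just-injective (trans (sym (block-labelled x∈block)) labelled′)
    ... | refl = All¬⇒¬Any g∉gs g′∈gs

length-concatMap : ∀ {A B : Set} (f : B → List A) {k : ℕ} → (∀ g → length (f g) ≡ k) →
  ∀ gs → length (concatMap f gs) ≡ k * length gs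
length-concatMap f {k} len-f []       = sym (*-zeroʳ k)
length-concatMap f {k} len-f (g ∷ gs) = begin
  length (f g ++ concatMap f gs)         ≡⟨ length-++ (f g) ⟩
  length (f g) + length (concatMap f gs) ≡⟨ cong₂ _+_ (len-f g) (length-concatMap f len-f gs) ⟩
  k + k * length gs                      ≡⟨ sym (*-suc k (length gs)) ⟩
  k * suc (length gs)                    ∎
  where open ≡-Reasoning

-- Finite search

first-success : ∀ {B : Set} {P Q : B → Set} (gs : List B) → (∀ g → P g ⊎ Q g) →
  (∃ P) ⊎ (∀ {g} → g ∈ gs → Q g)
first-success []       P⊎Q = inj₂ (λ ())
first-success (g ∷ gs) P⊎Q with P⊎Q g | first-success gs P⊎Q
... | inj₁ p | _       = inj₁ (g , p)
... | inj₂ _ | inj₁ p  = inj₁ p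
... | inj₂ q | inj₂ qs = inj₂ λ { (here refl) → q ; (there g∈gs) → qs g∈gs }

∃-Vec-Bool? : ∀ k {P : Vec Bool k → Set} → (∀ v → Dec (P v)) → Dec (∃ P)
∃-Vec-Bool? zero    P? = map′ ([] ,_) (λ { ([] , p) → p }) (P? [])
∃-Vec-Bool? (suc k) {P} P? = map′ join split
  (∃-Vec-Bool? k (P? ∘ (true ∷_)) ⊎-dec ∃-Vec-Bool? k (P? ∘ (false ∷_)))
  where
  join : ∃ (P ∘ (true ∷_)) ⊎ ∃ (P ∘ (false ∷_)) → ∃ P
  join (inj₁ (v , p)) = true ∷ v , p
  join (inj₂ (v , p)) = false ∷ v , p
  split : ∃ P → ∃ (P ∘ (true ∷_)) ⊎ ∃ (P ∘ (false ∷_))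
  split (true  ∷ v , p) = inj₁ (v , p)
  split (false ∷ v , p) = inj₂ (v , p)

-- Clauses of F, their triangles, and potentials

Hits : ∀ {A : Set} → List A → A × A × A → Set
Hits T (p , q , r) = (p ∈ T) ⊎ (q ∈ T) ⊎ (r ∈ T)

TriangleArc : ∀ {A : Set} → A × A × A → A → A → Set
TriangleArc (p , q , r) u v = ((u ≡ p) × (v ≡ q)) ⊎ ((u ≡ q) × (v ≡ r)) ⊎ ((u ≡ r) × (v ≡ p))

module _ {A : Set} (_≟_ : DecidableEquality A) (R : A → A → Set) (T : List A) (h : A → ℕ)
         (ascending : ∀ {u v} → R u v → u ∉ T → v ∉ T → h u < h v) where
  open import Data.List.Membership.DecPropositional _≟_ using (_∈?_)

  path-ascends : ∀ x vs v → Linked R (x ∷ vs ∷ʳ v) → All (_∉ T) (x ∷ vs) → v ∉ T → h x < h v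
  path-ascends x []       v (x→v ∷ₗ _)    (x∉ ∷ _)                v∉ = ascending x→v x∉ v∉
  path-ascends x (t ∷ vs) v (x→t ∷ₗ path) (x∉ ∷ avoid@(t∉ ∷ _)) v∉ =
    <-trans (ascending x→t x∉ t∉) (path-ascends t vs v path avoid v∉)

  potential⇒meets-cycles : ∀ v vs → Linked R ((v ∷ vs) ∷ʳ v) → Any (_∈ T) (v ∷ vs)
  potential⇒meets-cycles v vs cycle with any? (_∈? T) (v ∷ vs)
  ... | yes hit  = hit
  ... | no  miss with ¬Any⇒All¬ (v ∷ vs) miss
  ...   | avoid@(v∉ ∷ _) = ⊥-elim (<-irrefl refl (path-ascends v vs v cycle avoid v∉))

-- Enumeration of the vertex set U_3

module _ {n m : ℕ} where

  label : V n m → Maybe (G n m)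
  label z     = nothing
  label (α g) = just g
  label (β g) = just g
  label (a g) = just g
  label (b g) = just g
  label (c g) = just g

  elements : List (G n m)
  elements = map y (allFin n) ++ map w (allFin m)

  elements-complete : ∀ g → g ∈ elements
  elements-complete (y u) = ∈-++⁺ˡ (∈-map⁺ y (∈-allFin u))
  elements-complete (w r) = ∈-++⁺ʳ (map y (allFin n)) (∈-map⁺ w (∈-allFin r))

  elements-unique : Unique elements
  elements-unique = ++⁺ (map⁺ (λ { refl → refl }) (allFin⁺ n)) (map⁺ (λ { refl → refl }) (allFin⁺ m)) y≢w
    where
    y≢w : ∀ {g} → ¬ (g ∈ map y (allFin n) × g ∈ map w (allFin m))
    y≢w (g∈ys , g∈ws) with ∈-map⁻ y g∈ys | ∈-map⁻ w g∈ws
    ... | _ , _ , refl | _ , _ , ()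

  elements-length : length elements ≡ n + m
  elements-length = begin
    length (map y (allFin n) ++ map w (allFin m))           ≡⟨ length-++ (map y (allFin n)) ⟩
    length (map y (allFin n)) + length (map w (allFin m))   ≡⟨ cong₂ _+_ (count y) (count w) ⟩
    n + m                                                   ∎
    where
    open ≡-Reasoning
    count : ∀ {k} (f : Fin k → G n m) → length (map f (allFin k)) ≡ k
    count {k} f = trans (length-map f (allFin k)) (length-tabulate {n = k} (λ i → i))

  module _ (block : G n m → List (V n m)) (block-labelled : ∀ {g x} → x ∈ block g → label x ≡ just g) where
    open Blocks label block block-labelled

    per-gadget-unique : (∀ g → Unique (block g)) → Unique (concatMap block elements)
    per-gadget-unique = blocks-unique elements-unique

    per-gadget-length : ∀ {k} → (∀ g → length (block g) ≡ k) → length (concatMap block elements) ≡ k * (n + m)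
    per-gadget-length {k} len = trans (length-concatMap block len elements) (cong (k *_) elements-length)

    ∈-per-gadget : ∀ {x} g → x ∈ block g → x ∈ concatMap block elements
    ∈-per-gadget g = block⊆blocks (elements-complete g)

  gadget : G n m → List (V n m)
  gadget g = α g ∷ β g ∷ a g ∷ b g ∷ c g ∷ []

  gadget-labelled : ∀ {g x} → x ∈ gadget g → label x ≡ just g
  gadget-labelled (here refl)                                 = refl
  gadget-labelled (there (here refl))                         = refl
  gadget-labelled (there (there (here refl)))                 = refl
  gadget-labelled (there (there (there (here refl))))         = refl
  gadget-labelled (there (there (there (there (here refl))))) = refl

  gadget-unique : ∀ g → Unique (gadget g)
  gadget-unique g = ((λ ()) ∷ (λ ()) ∷ (λ ()) ∷ (λ ()) ∷ []) ∷ ((λ ()) ∷ (λ ()) ∷ (λ ()) ∷ [])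
                  ∷ ((λ ()) ∷ (λ ()) ∷ []) ∷ ((λ ()) ∷ []) ∷ [] ∷ []

  vertices : List (V n m)
  vertices = z ∷ concatMap gadget elements

  vertices-complete : ∀ v → v ∈ vertices
  vertices-complete z     = here refl
  vertices-complete (α g) = there (∈-per-gadget gadget gadget-labelled g (here refl))
  vertices-complete (β g) = there (∈-per-gadget gadget gadget-labelled g (there (here refl)))
  vertices-complete (a g) = there (∈-per-gadget gadget gadget-labelled g (there (there (here refl))))
  vertices-complete (b g) = there (∈-per-gadget gadget gadget-labelled g (there (there (there (here refl)))))
  vertices-complete (c g) = there (∈-per-gadget gadget gadget-labelled g (there (there (there (there (here refl))))))

  vertices-unique : Unique vertices
  vertices-unique = ¬Any⇒All¬ _ (Blocks.unlabelled∉blocks label gadget gadget-labelled {elements} refl)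
                  ∷ per-gadget-unique gadget gadget-labelled gadget-unique

  vertex-count : ∀ {N} → V n m ↔ Fin N → N ≡ suc (5 * (n + m))
  vertex-count V↔Fin = trans (sym (enumeration-length vertices-unique vertices-complete V↔Fin))
                             (cong suc (per-gadget-length gadget gadget-labelled (λ _ → refl)))

-- Satisfiability of the 3-CNF C

Assignment : ℕ → Set
Assignment n = Vec Bool n

_⊨_ : ∀ {n} → Assignment n → Clause3 n → Set
v ⊨ cl = (lookup v (i cl) ≡ si cl) ⊎ (lookup v (j cl) ≡ sj cl) ⊎ (lookup v (k cl) ≡ sk cl)
  where open Clause3

_⊨?_ : ∀ {n} (v : Assignment n) (cl : Clause3 n) → Dec (v ⊨ cl)
v ⊨? cl = (lookup v (i cl) ≟ᵇ si cl) ⊎-dec (lookup v (j cl) ≟ᵇ sj cl) ⊎-dec (lookup v (k cl) ≟ᵇ sk cl)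
  where open Clause3

Satisfiable : ∀ {n m} → (Fin m → Clause3 n) → Set
Satisfiable {n} C = ∃ λ (v : Assignment n) → ∀ r → v ⊨ C r

satisfiable? : ∀ {n m} (C : Fin m → Clause3 n) → Dec (Satisfiable C)
satisfiable? {n} C = ∃-Vec-Bool? n (λ v → all? (λ r → v ⊨? C r))

-- An unsatisfiable formula has a clause: a universal statement over Fin 0 holds.
some-index : ∀ {m} {P : Fin m → Set} → ¬ (∀ r → P r) → Fin m
some-index {zero}  ¬all = ⊥-elim (¬all (λ ()))
some-index {suc m} ¬all = Fin.zero

-- The reduction: C against its M-NAE version F.  Decidable equality of
-- vertices is a parameter; it follows from V n m being finite.

module Reduction {n m : ℕ} (C : Fin m → Clause3 n) (_≟_ : DecidableEquality (V n m)) where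
  open Clause3
  open import Data.List.Membership.DecPropositional _≟_ using (_∈?_)

  -- two vertices per gadget
  K₀ : ℕ
  K₀ = 2 * (n + m)

  label-γ : ∀ u s → label {n} {m} (γ u s) ≡ just (y u)
  label-γ u true  = refl
  label-γ u false = refl

  ≢γ : ∀ {x : V n m} {u s} → label x ≢ just (y u) → x ≢ γ u s
  ≢γ {u = u} {s} x∉gadget refl = x∉gadget (label-γ u s)

  lit₁ lit₂ lit₃ : FClause n m → V n m
  lit₁ cl = proj₁ (lits C cl)
  lit₂ cl = proj₁ (proj₂ (lits C cl))
  lit₃ cl = proj₂ (proj₂ (lits C cl))

  literals-distinct : ∀ cl → lit₁ cl ≢ lit₂ cl × lit₂ cl ≢ lit₃ cl × lit₃ cl ≢ lit₁ cl
  literals-distinct (first r) =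
      ≢γ (λ same → <⇒≢ (i<j (C r)) (y-injective (just-injective (trans (sym (label-γ _ _)) same))))
    , (λ γ≡α → ≢γ (λ ()) (sym γ≡α))
    , ≢γ (λ ())
    where
    y-injective : ∀ {u v} → y {n} {m} u ≡ y v → u ≡ v
    y-injective refl = refl
  literals-distinct (second r) = ≢γ (λ ()) , (λ γ≡z → ≢γ (λ ()) (sym γ≡z)) , (λ ())
  literals-distinct (gad1 g) = (λ ()) , (λ ()) , (λ ())
  literals-distinct (gad2 g) = (λ ()) , (λ ()) , (λ ())
  literals-distinct (gad3 g) = (λ ()) , (λ ()) , (λ ())
  literals-distinct (gad4 g) = (λ ()) , (λ ()) , (λ ())

  clause-cycle : ∀ cl → IsCycle C (lit₁ cl) (lit₂ cl ∷ lit₃ cl ∷ [])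
  clause-cycle cl with literals-distinct cl
  ... | p≢q , q≢r , r≢p =
      ((p≢q ∷ (λ p≡r → r≢p (sym p≡r)) ∷ []) ∷ (q≢r ∷ []) ∷ [] ∷ [])
    , ((cl , inj₁ (refl , refl)) ∷ₗ (cl , inj₂ (inj₁ (refl , refl))) ∷ₗ (cl , inj₂ (inj₂ (refl , refl))) ∷ₗ [-])

  -- every feedback vertex set satisfies F, since it meets every clause triangle
  fvs⇒satisfies : ∀ {S} → IsFVS C S → Satisfies C S
  fvs⇒satisfies (_ , _ , meets) cl with meets _ _ (clause-cycle cl)
  ... | here p∈S                = inj₁ p∈S
  ... | there (here q∈S)        = inj₂ (inj₁ q∈S)
  ... | there (there (here r∈S)) = inj₂ (inj₂ r∈S)

  both-optimal : ∀ {T} → IsFVS C T → Satisfies C T → (∀ T′ → Satisfies C T′ → length T ≤ length T′) →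
    IsMFVS C (length T) × IsTs C (length T)
  both-optimal {T} T-fvs T-sat minimal =
      ((T , T-fvs , refl) , λ S S-fvs → minimal S (fvs⇒satisfies S-fvs))
    , ((T , proj₁ T-fvs , T-sat , refl) , λ T′ _ T′-sat → minimal T′ T′-sat)

  module Lower {T : List (V n m)} (T-sat : Satisfies C T) where

    -- exactly one of α_g, β_g is in T: the gadget encodes a truth value
    Exact : G n m → Set
    Exact g = (α g ∈ T × β g ∉ T) ⊎ (α g ∉ T × β g ∈ T)

    record Pair (g : G n m) : Set where
      constructor pair
      field
        fst snd   : V n m
        fst∈T     : fst ∈ T
        snd∈T     : snd ∈ T
        fst-label : label fst ≡ just g
        snd-label : label snd ≡ just g
        fst≢snd   : fst ≢ snd

      members : List (V n m)
      members = fst ∷ snd ∷ []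

    open Pair

    Third : ∀ {g} → Pair g → Set
    Third {g} P = ∃ λ x → x ∈ T × label x ≡ just g × x ∉ members P

    forced : ∀ {p q r} → (p ∈ T) ⊎ (q ∈ T) ⊎ (r ∈ T) → p ∉ T → q ∉ T → r ∈ T
    forced (inj₁ p∈)        p∉ _  = ⊥-elim (p∉ p∈)
    forced (inj₂ (inj₁ q∈)) _  q∉ = ⊥-elim (q∉ q∈)
    forced (inj₂ (inj₂ r∈)) _  _  = r∈

    letter∈T : ∀ g → ∃ λ x → x ∈ T × label x ≡ just g × x ∉ α g ∷ β g ∷ []
    letter∈T g with T-sat (gad4 g)
    ... | inj₁ a∈        = a g , a∈ , refl , λ { (here ()) ; (there (here ())) }
    ... | inj₂ (inj₁ b∈) = b g , b∈ , refl , λ { (here ()) ; (there (here ())) }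
    ... | inj₂ (inj₂ c∈) = c g , c∈ , refl , λ { (here ()) ; (there (here ())) }

    analyse : ∀ g → Σ (Pair g) λ P → Third P ⊎ Exact g
    analyse g with α g ∈? T | β g ∈? T | letter∈T g
    ... | yes α∈ | yes β∈ | x , x∈ , x-label , x∉ =
      pair (α g) (β g) α∈ β∈ refl refl (λ ()) , inj₁ (x , x∈ , x-label , x∉)
    ... | yes α∈ | no  β∉ | x , x∈ , x-label , x∉ =
      pair (α g) x α∈ x∈ refl x-label (λ α≡x → x∉ (here (sym α≡x))) , inj₂ (inj₁ (α∈ , β∉))
    ... | no  α∉ | yes β∈ | x , x∈ , x-label , x∉ =
      pair (β g) x β∈ x∈ refl x-label (λ β≡x → x∉ (there (here (sym β≡x)))) , inj₂ (inj₂ (α∉ , β∈))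
    ... | no  α∉ | no  β∉ | _ =
      pair (a g) (b g) (forced (T-sat (gad1 g)) α∉ β∉) (forced (T-sat (gad2 g)) α∉ β∉) refl refl (λ ())
      , inj₁ (c g , forced (T-sat (gad3 g)) α∉ β∉ , refl , λ { (here ()) ; (there (here ())) })

    counted : G n m → List (V n m)
    counted g = members (proj₁ (analyse g))

    counted-labelled : ∀ {g x} → x ∈ counted g → label x ≡ just g
    counted-labelled {g} (here refl)         = fst-label (proj₁ (analyse g))
    counted-labelled {g} (there (here refl)) = snd-label (proj₁ (analyse g))

    open Blocks label counted counted-labelled using (blocks-member; labelled∉blocks; unlabelled∉blocks)

    W : List (V n m)
    W = concatMap counted elements

    W-unique : Unique W
    W-unique = per-gadget-unique counted counted-labelled
      (λ g → (fst≢snd (proj₁ (analyse g)) ∷ []) ∷ [] ∷ [])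

    W⊆T : ∀ {x} → x ∈ W → x ∈ T
    W⊆T x∈W with blocks-member {elements} x∈W
    ... | g , _ , _ , here refl         = fst∈T (proj₁ (analyse g))
    ... | g , _ , _ , there (here refl) = snd∈T (proj₁ (analyse g))

    W-length : length W ≡ K₀
    W-length = per-gadget-length counted counted-labelled (λ _ → refl)

    at-least-K₀ : K₀ ≤ length T
    at-least-K₀ = subst (_≤ length T) W-length (unique⊆⇒length≤ W-unique W⊆T)

    beyond-W : ∀ {x} → x ∈ T → x ∉ W → suc K₀ ≤ length T
    beyond-W {x} x∈T x∉W = subst (λ k → suc k ≤ length T) W-length
      (unique⊆⇒length≤ (¬Any⇒All¬ W x∉W ∷ W-unique) λ { (here refl) → x∈T ; (there x∈W) → W⊆T x∈W })

    assignment : Assignment n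
    assignment = tabulate (λ u → does (α (y u) ∈? T))

    decode-literal : ∀ {u s} → Exact (y u) → γ u s ∈ T → lookup assignment u ≡ s
    decode-literal {u} {s} exact γ∈T
      rewrite lookup∘tabulate (λ u → does (α (y u) ∈? T)) u with s | α (y u) ∈? T
    ... | true  | yes _  = refl
    ... | true  | no α∉  = ⊥-elim (α∉ γ∈T)
    ... | false | no _   = refl
    ... | false | yes α∈ with exact
    ...   | inj₁ (_ , β∉) = ⊥-elim (β∉ γ∈T)
    ...   | inj₂ (α∉ , _) = ⊥-elim (α∉ α∈)

    decode : (∀ g → Exact g) → z ∉ T → Satisfiable C
    decode exact z∉ = assignment , satisfied
      where
      satisfied : ∀ r → assignment ⊨ C r
      satisfied r with T-sat (first r)
      ... | inj₁ γi∈        = inj₁ (decode-literal (exact _) γi∈)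
      ... | inj₂ (inj₁ γj∈) = inj₂ (inj₁ (decode-literal (exact _) γj∈))
      ... | inj₂ (inj₂ αw∈) with T-sat (second r) | exact (w r)
      ...   | inj₂ (inj₁ γk∈) | _              = inj₂ (inj₂ (decode-literal (exact _) γk∈))
      ...   | inj₂ (inj₂ z∈)  | _              = ⊥-elim (z∉ z∈)
      ...   | inj₁ βw∈        | inj₁ (_ , βw∉) = ⊥-elim (βw∉ βw∈)
      ...   | inj₁ _          | inj₂ (αw∉ , _) = ⊥-elim (αw∉ αw∈)

    -- for unsatisfiable C some vertex of T lies outside W: z, or a third gadget vertex
    at-least-suc-K₀ : ¬ Satisfiable C → suc K₀ ≤ length T
    at-least-suc-K₀ unsat with z ∈? T
    ... | yes z∈ = beyond-W z∈ (unlabelled∉blocks {elements} refl)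
    ... | no z∉ with first-success elements (λ g → proj₂ (analyse g))
    ...   | inj₁ (g , x , x∈ , x-label , x∉) = beyond-W x∈ (labelled∉blocks {elements} x-label x∉)
    ...   | inj₂ exact = ⊥-elim (unsat (decode (λ g → exact (elements-complete g)) z∉))

  choose : Bool → G n m → V n m
  choose true  = α
  choose false = β

  γ-choose : ∀ u s → γ u s ≡ choose s (y u)
  γ-choose u true  = refl
  γ-choose u false = refl

  module Upper (zs : List (V n m)) (truth : G n m → Bool) where

    selected : G n m → List (V n m)
    selected g = choose (truth g) g ∷ a g ∷ []

    selected-labelled : ∀ {g x} → x ∈ selected g → label x ≡ just g
    selected-labelled {g} (here refl) with truth g
    ... | true  = refl
    ... | false = refl
    selected-labelled (there (here refl)) = refl

    open Blocks label selected selected-labelled using (labelled∉blocks; unlabelled∉blocks)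

    L : List (V n m)
    L = concatMap selected elements

    TL : List (V n m)
    TL = zs ++ L

    chosen∈ : ∀ g → choose (truth g) g ∈ TL
    chosen∈ g = ∈-++⁺ʳ zs (∈-per-gadget selected selected-labelled g (here refl))

    a∈ : ∀ g → a g ∈ TL
    a∈ g = ∈-++⁺ʳ zs (∈-per-gadget selected selected-labelled g (there (here refl)))

    L-length : length L ≡ K₀
    L-length = per-gadget-length selected selected-labelled (λ _ → refl)

    z∉L : z ∉ L
    z∉L = unlabelled∉blocks {elements} refl

    b∉L : ∀ g → b g ∉ L
    b∉L g = labelled∉blocks {elements} refl (b∉selected (truth g))
      where
      b∉selected : ∀ s → b g ∉ choose s g ∷ a g ∷ []
      b∉selected true  (here ())
      b∉selected false (here ())
      b∉selected _     (there (here ()))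

    covered : ∀ g → α g ∉ TL → β g ∉ TL → ⊥
    covered g α∉ β∉ with truth g | chosen∈ g
    ... | true  | α∈ = α∉ α∈
    ... | false | β∈ = β∉ β∈

    covered-hit : ∀ {x} g → (α g ∈ TL) ⊎ (β g ∈ TL) ⊎ (x ∈ TL)
    covered-hit g with truth g | chosen∈ g
    ... | true  | α∈ = inj₁ α∈
    ... | false | β∈ = inj₂ (inj₁ β∈)

    satisfies : (∀ r → Hits TL (lits C (first r))) → (∀ r → Hits TL (lits C (second r))) → Satisfies C TL
    satisfies first-hit second-hit (first r)  = first-hit r
    satisfies first-hit second-hit (second r) = second-hit r
    satisfies first-hit second-hit (gad1 g)   = covered-hit g
    satisfies first-hit second-hit (gad2 g)   = covered-hit g
    satisfies first-hit second-hit (gad3 g)   = covered-hit g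
    satisfies first-hit second-hit (gad4 g)   = inj₁ (a∈ g)

    -- A potential h on z, α_g, β_g with h(β_g) < B and 2 ≤ h(α_g) extends to the
    -- gadgets: b_g, c_g go above β_g if α_g is chosen and below α_g otherwise,
    -- so that it ascends along every gadget arc avoiding TL.
    module Potential (h : V n m → ℕ) (B : ℕ)
                     (β-below : ∀ g → h (β g) < B) (α-above : ∀ g → 2 ≤ h (α g)) where

      H : V n m → ℕ
      H (a g) = 0
      H (b g) = if truth g then B else 0
      H (c g) = if truth g then suc B else 1
      H v     = h v

      Ascends : V n m × V n m × V n m → Set
      Ascends t = ∀ {u v} → TriangleArc t u v → u ∉ TL → v ∉ TL → H u < H v

      β<b : ∀ g → β g ∉ TL → H (β g) < H (b g)
      β<b g β∉ with truth g | chosen∈ g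
      ... | true  | _  = β-below g
      ... | false | β∈ = ⊥-elim (β∉ β∈)

      β<c : ∀ g → β g ∉ TL → H (β g) < H (c g)
      β<c g β∉ with truth g | chosen∈ g
      ... | true  | _  = <-trans (β-below g) (n<1+n B)
      ... | false | β∈ = ⊥-elim (β∉ β∈)

      b<α : ∀ g → α g ∉ TL → H (b g) < H (α g)
      b<α g α∉ with truth g | chosen∈ g
      ... | true  | α∈ = ⊥-elim (α∉ α∈)
      ... | false | _  = ≤-trans (s≤s z≤n) (α-above g)

      c<α : ∀ g → α g ∉ TL → H (c g) < H (α g)
      c<α g α∉ with truth g | chosen∈ g
      ... | true  | α∈ = ⊥-elim (α∉ α∈)
      ... | false | _  = α-above g

      b<c : ∀ g → H (b g) < H (c g)
      b<c g with truth g
      ... | true  = n<1+n B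
      ... | false = n<1+n 0

      ascends : (∀ r → Ascends (lits C (first r))) → (∀ r → Ascends (lits C (second r))) →
        ∀ {u v} → Arc C u v → u ∉ TL → v ∉ TL → H u < H v
      ascends first-asc second-asc (first r  , arc) = first-asc r arc
      ascends first-asc second-asc (second r , arc) = second-asc r arc
      ascends _ _ (gad1 g , inj₁ (refl , refl))         α∉ β∉ = ⊥-elim (covered g α∉ β∉)
      ascends _ _ (gad1 g , inj₂ (inj₁ (refl , refl)))  _  a∉ = ⊥-elim (a∉ (a∈ g))
      ascends _ _ (gad1 g , inj₂ (inj₂ (refl , refl)))  a∉ _  = ⊥-elim (a∉ (a∈ g))
      ascends _ _ (gad2 g , inj₁ (refl , refl))         α∉ β∉ = ⊥-elim (covered g α∉ β∉)
      ascends _ _ (gad2 g , inj₂ (inj₁ (refl , refl)))  β∉ _  = β<b g β∉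
      ascends _ _ (gad2 g , inj₂ (inj₂ (refl , refl)))  _  α∉ = b<α g α∉
      ascends _ _ (gad3 g , inj₁ (refl , refl))         α∉ β∉ = ⊥-elim (covered g α∉ β∉)
      ascends _ _ (gad3 g , inj₂ (inj₁ (refl , refl)))  β∉ _  = β<c g β∉
      ascends _ _ (gad3 g , inj₂ (inj₂ (refl , refl)))  _  α∉ = c<α g α∉
      ascends _ _ (gad4 g , inj₁ (refl , refl))         a∉ _  = ⊥-elim (a∉ (a∈ g))
      ascends _ _ (gad4 g , inj₂ (inj₁ (refl , refl)))  _  _  = b<c g
      ascends _ _ (gad4 g , inj₂ (inj₂ (refl , refl)))  _  a∉ = ⊥-elim (a∉ (a∈ g))

      fvs : Unique zs → (∀ {x} → x ∈ zs → x ∉ L) → (∃ λ v → v ∉ TL) →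
        (∀ r → Ascends (lits C (first r))) → (∀ r → Ascends (lits C (second r))) → IsFVS C TL
      fvs zs! zs∩L outside first-asc second-asc =
          ++⁺ zs! (per-gadget-unique selected selected-labelled selected-unique) (λ (x∈zs , x∈L) → zs∩L x∈zs x∈L)
        , outside
        , λ v vs (_ , cycle) → potential⇒meets-cycles _≟_ (Arc C) TL H (ascends first-asc second-asc) v vs cycle
        where
        selected-unique : ∀ g → Unique (selected g)
        selected-unique g with truth g
        ... | true  = ((λ ()) ∷ []) ∷ [] ∷ []
        ... | false = ((λ ()) ∷ []) ∷ [] ∷ []

  -- Satisfiable C, with assignment v: choose α_{y_u} iff x_u is true, and α_{w_r}
  -- iff the literal of C_r found true is its third.
  module SatCase (v : Assignment n) (v⊨C : ∀ r → v ⊨ C r) where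

    third-literal : ∀ {cl} → v ⊨ cl → Bool
    third-literal (inj₂ (inj₂ _)) = true
    third-literal _               = false

    truth : G n m → Bool
    truth (y u) = lookup v u
    truth (w r) = third-literal {C r} (v⊨C r)

    open Upper [] truth

    true-literal∈ : ∀ {u s} → lookup v u ≡ s → γ u s ∈ TL
    true-literal∈ {u} refl = subst (_∈ TL) (sym (γ-choose u (lookup v u))) (chosen∈ (y u))

    -- α_{w_r} sits above γ_j if l_i is the true literal, below γ_i if l_j is
    αw-height : ∀ {cl} → v ⊨ cl → ℕ
    αw-height (inj₁ _) = 3 + n
    αw-height _        = 2

    h : V n m → ℕ
    h z         = 4 + n
    h (α (y u)) = 3 + toℕ u
    h (β (y u)) = 3 + toℕ u
    h (α (w r)) = αw-height {C r} (v⊨C r)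
    h (β (w r)) = 5 + n
    h _         = 0

    β-below : ∀ g → h (β g) < 6 + n
    β-below (y u) = ≤-trans (+-monoʳ-< 3 (toℕ<n u)) (m≤n+m (3 + n) 3)
    β-below (w r) = n<1+n (5 + n)

    α-above : ∀ g → 2 ≤ h (α g)
    α-above (y u) = s≤s (s≤s z≤n)
    α-above (w r) with v⊨C r
    ... | inj₁ _ = s≤s (s≤s z≤n)
    ... | inj₂ _ = s≤s (s≤s z≤n)

    open Potential h (6 + n) β-below α-above

    H-γ : ∀ u s → H (γ u s) ≡ 3 + toℕ u
    H-γ u true  = refl
    H-γ u false = refl

    first-ascends : ∀ r → Ascends (lits C (first r))
    first-ascends r (inj₁ (refl , refl)) _ _ =
      subst₂ _<_ (sym (H-γ (i (C r)) (si (C r)))) (sym (H-γ (j (C r)) (sj (C r)))) (+-monoʳ-< 3 (i<j (C r)))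
    first-ascends r (inj₂ (inj₁ (refl , refl))) γj∉ αw∉ with v⊨C r | chosen∈ (w r)
    ... | inj₁ _         | _   = subst (_< 3 + n) (sym (H-γ (j (C r)) (sj (C r)))) (+-monoʳ-< 3 (toℕ<n (j (C r))))
    ... | inj₂ (inj₁ lj) | _   = ⊥-elim (γj∉ (true-literal∈ lj))
    ... | inj₂ (inj₂ _)  | αw∈ = ⊥-elim (αw∉ αw∈)
    first-ascends r (inj₂ (inj₂ (refl , refl))) αw∉ γi∉ with v⊨C r | chosen∈ (w r)
    ... | inj₁ li        | _   = ⊥-elim (γi∉ (true-literal∈ li))
    ... | inj₂ (inj₁ _)  | _   = subst (2 <_) (sym (H-γ (i (C r)) (si (C r)))) (s≤s (s≤s (s≤s z≤n)))
    ... | inj₂ (inj₂ _)  | αw∈ = ⊥-elim (αw∉ αw∈)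

    second-ascends : ∀ r → Ascends (lits C (second r))
    second-ascends r (inj₁ (refl , refl)) βw∉ γk∉ with v⊨C r | chosen∈ (w r)
    ... | inj₁ _         | βw∈ = ⊥-elim (βw∉ βw∈)
    ... | inj₂ (inj₁ _)  | βw∈ = ⊥-elim (βw∉ βw∈)
    ... | inj₂ (inj₂ lk) | _   = ⊥-elim (γk∉ (true-literal∈ lk))
    second-ascends r (inj₂ (inj₁ (refl , refl))) _ _ =
      subst (_< 4 + n) (sym (H-γ (k (C r)) (sk (C r)))) (<-trans (+-monoʳ-< 3 (toℕ<n (k (C r)))) (n<1+n (3 + n)))
    second-ascends r (inj₂ (inj₂ (refl , refl))) _ _ = n<1+n (4 + n)

    first-hit : ∀ r → Hits TL (lits C (first r))
    first-hit r with v⊨C r | chosen∈ (w r)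
    ... | inj₁ li        | _   = inj₁ (true-literal∈ li)
    ... | inj₂ (inj₁ lj) | _   = inj₂ (inj₁ (true-literal∈ lj))
    ... | inj₂ (inj₂ _)  | αw∈ = inj₂ (inj₂ αw∈)

    second-hit : ∀ r → Hits TL (lits C (second r))
    second-hit r with v⊨C r | chosen∈ (w r)
    ... | inj₁ _         | βw∈ = inj₁ βw∈
    ... | inj₂ (inj₁ _)  | βw∈ = inj₁ βw∈
    ... | inj₂ (inj₂ lk) | _   = inj₂ (inj₁ (true-literal∈ lk))

    cover : List (V n m)
    cover = TL

    cover-sat : Satisfies C cover
    cover-sat = satisfies first-hit second-hit

    cover-fvs : IsFVS C cover
    cover-fvs = fvs [] (λ ()) (z , z∉L) first-ascends second-ascends

    cover-length : length cover ≡ K₀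
    cover-length = L-length

  -- Unsatisfiable C: take z and every α_g; the β_{y_u} left outside are ordered by u.
  module UnsatCase (unsat : ¬ Satisfiable C) where

    open Upper (z ∷ []) (λ _ → true)

    h : V n m → ℕ
    h (α _)     = 2
    h (β (y u)) = 1 + toℕ u
    h _         = 0

    β-below : ∀ g → h (β g) < 1 + n
    β-below (y u) = s≤s (toℕ<n u)
    β-below (w r) = s≤s z≤n

    open Potential h (1 + n) β-below (λ _ → s≤s (s≤s z≤n))

    H-γ : ∀ {u s} → γ u s ∉ TL → H (γ u s) ≡ 1 + toℕ u
    H-γ {u} {true}  α∉ = ⊥-elim (α∉ (chosen∈ (y u)))
    H-γ {u} {false} _  = refl

    -- only γ_i → γ_j and β_{w_r} → γ_k can avoid TL
    first-ascends : ∀ r → Ascends (lits C (first r))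
    first-ascends r (inj₁ (refl , refl)) γi∉ γj∉ = subst₂ _<_ (sym (H-γ γi∉)) (sym (H-γ γj∉)) (s≤s (i<j (C r)))
    first-ascends r (inj₂ (inj₁ (refl , refl))) _ αw∉ = ⊥-elim (αw∉ (chosen∈ (w r)))
    first-ascends r (inj₂ (inj₂ (refl , refl))) αw∉ _ = ⊥-elim (αw∉ (chosen∈ (w r)))

    second-ascends : ∀ r → Ascends (lits C (second r))
    second-ascends r (inj₁ (refl , refl)) _ γk∉ = subst (0 <_) (sym (H-γ γk∉)) (s≤s z≤n)
    second-ascends r (inj₂ (inj₁ (refl , refl))) _ z∉ = ⊥-elim (z∉ (here refl))
    second-ascends r (inj₂ (inj₂ (refl , refl))) z∉ _ = ⊥-elim (z∉ (here refl))

    -- b_{w_r} for some clause C_r, which exists since C is unsatisfiable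
    outside : ∃ λ v → v ∉ TL
    outside = b (w r) , λ { (here ()) ; (there b∈L) → b∉L (w r) b∈L }
      where
      r : Fin m
      r = some-index (λ all → unsat (replicate n false , all))

    cover : List (V n m)
    cover = TL

    cover-sat : Satisfies C cover
    cover-sat = satisfies (λ r → inj₂ (inj₂ (chosen∈ (w r)))) (λ r → inj₂ (inj₂ (here refl)))

    cover-fvs : IsFVS C cover
    cover-fvs = fvs ([] ∷ []) (λ { (here refl) → z∉L }) outside first-ascends second-ascends

    cover-length : length cover ≡ suc K₀
    cover-length = cong suc L-length

  optimum : ∃ λ k → (IsMFVS C k × IsTs C k) × (k ≡ K₀ ⊎ k ≡ suc K₀)
  optimum with satisfiable? C
  ... | yes (v , v⊨C) = _ , both-optimal cover-fvs cover-sat minimal , inj₁ cover-length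
    where
    open SatCase v v⊨C
    minimal : ∀ T′ → Satisfies C T′ → length cover ≤ length T′
    minimal T′ T′-sat = subst (_≤ length T′) (sym cover-length) (Lower.at-least-K₀ T′-sat)
  ... | no unsat = _ , both-optimal cover-fvs cover-sat minimal , inj₂ cover-length
    where
    open UnsatCase unsat
    minimal : ∀ T′ → Satisfies C T′ → length cover ≤ length T′
    minimal T′ T′-sat = subst (_≤ length T′) (sym cover-length) (Lower.at-least-suc-K₀ T′-sat unsat)

2*5*s≡5*2*s : ∀ s → 2 * (5 * s) ≡ 5 * (2 * s)
2*5*s≡5*2*s s = trans (sym (*-assoc 2 5 s)) (*-assoc 5 2 s)

-- 2(N-1)/5 ≤ k ≤ 2(N-1)/5 + 1 for N - 1 = 5s and k ∈ {2s, 2s + 1}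
bounds : ∀ s {k} → k ≡ 2 * s ⊎ k ≡ suc (2 * s) → 2 * (5 * s) ≤ 5 * k × 5 * k ≤ 2 * (5 * s) + 5
bounds s (inj₁ refl) = ≤-reflexive (2*5*s≡5*2*s s) , ≤-trans (≤-reflexive (sym (2*5*s≡5*2*s s))) (m≤m+n _ 5)
bounds s (inj₂ refl) rewrite *-suc 5 (2 * s) | 2*5*s≡5*2*s s =
  m≤n+m (5 * (2 * s)) 5 , ≤-reflexive (+-comm 5 (5 * (2 * s)))

claim5 : ∀ (n m : ℕ) (C : Fin m → Clause3 n) (N : ℕ) → (V n m ↔ Fin N) →
    ∃ λ k → IsMFVS C k × IsTs C k
      × 2 * (N ∸ 1) ≤ 5 * k × 5 * k ≤ 2 * (N ∸ 1) + 5
claim5 n m C N V↔Fin with Reduction.optimum C (inj⇒≟ (↔⇒↣ V↔Fin)) | vertex-count V↔Fin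
... | k , (mfvs , ts) , k∈ | refl = k , mfvs , ts , bounds (n + m) k∈
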